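{- Let $n\ge1$, $D_n=\langle a,b\mid a^n=b^2=1,\ bab=a^{ -1}\rangle$, and $T\subseteq\langle a\rangle$. If $T\in B(\langle a\rangle)$, then for all $1\le h\le\lfloor\frac{n-1}{2}\rfloor$, $\chi_h(T)$ and $\chi_h(T^2)$ are integers and $2\chi_h(T^2)$ is a square number.
   Context: $\chi_h$ is the character of $D_n$ with $\chi_h(a^k)=2\cos(\frac{2kh\pi}{n})$, $\chi_h(ba^k)=0$; $\chi_h(T)=\sum_{x\in T}\chi_h(x)$ and $\chi_h(T^2)=\sum_{x,y\in T}\chi_h(xy)$. A square number is an integer $w^2$, $w\in\mathbb{Z}$. $B(\langle a\rangle)$ is the Boolean algebra of subsets of $\langle a\rangle$ generated by its subgroups under finite unions, intersections and complements; equivalently, unions of atoms $[g]=\{x\in\langle a\rangle:\langle x\rangle=\langle g\rangle\}$. -}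

module Defs where

open import Data.Nat using (ℕ; zero; suc; _∸_; _%_; NonZero) renaming (_+_ to _+ℕ_; _*_ to _*ℕ_)
open import Data.Nat.DivMod using (m%n<n)
open import Data.Integer using (ℤ; +_; -[1+_])
open import Data.Fin using (Fin; toℕ; fromℕ<)
open import Data.Fin.Subset using (Subset; _∈_; _∪_; _∩_; ∁)
open import Data.Vec using (lookup)
open import Data.Bool using (if_then_else_)
open import Data.Sum using (_⊎_)
open import Relation.Binary.PropositionalEquality using (_≡_)
open import Relation.Nullary using (¬_)
import Level
import Data.Product
import Data.Nat
open import Algebra.Bundles using (CommutativeRing)

-- The cyclic subgroup ⟨a⟩ ≅ ℤ/n of D_n : a^k is represented by k : Fin n.
-- A subset T ⊆ ⟨a⟩ is a 'Subset n' (= Vec Bool n).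

modF : (n : ℕ) .{{_ : NonZero n}} → ℕ → Fin n
modF n k = fromℕ< (m%n<n k n)

mulA : (n : ℕ) .{{_ : NonZero n}} → Fin n → Fin n → Fin n
mulA n i j = modF n (toℕ i +ℕ toℕ j)

invA : (n : ℕ) .{{_ : NonZero n}} → Fin n → Fin n
invA n i = modF n (n ∸ toℕ i)

record IsSubgroup (n : ℕ) .{{_ : NonZero n}} (H : Subset n) : Set where
  field
    one∈ : modF n 0 ∈ H
    mul∈ : ∀ {i j} → i ∈ H → j ∈ H → mulA n i j ∈ H
    inv∈ : ∀ {i} → i ∈ H → invA n i ∈ H

data InB (n : ℕ) .{{_ : NonZero n}} : Subset n → Set where
  sub   : ∀ {H} → IsSubgroup n H → InB n H
  union : ∀ {S U} → InB n S → InB n U → InB n (S ∪ U)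
  inter : ∀ {S U} → InB n S → InB n U → InB n (S ∩ U)
  compl : ∀ {S} → InB n S → InB n (∁ S)

-- Complex values are modelled inside an arbitrary integral domain R of
-- characteristic 0 containing a primitive n-th root of unity ζ
-- (e.g. R = ℂ, ζ = e^(2πi/n)).

module _ {c ℓ} (R : CommutativeRing c ℓ) where
  open CommutativeRing R

  pow : Carrier → ℕ → Carrier
  pow x zero    = 1#
  pow x (suc k) = x * pow x k

  natR : ℕ → Carrier
  natR zero    = 0#
  natR (suc k) = 1# + natR k

  intR : ℤ → Carrier
  intR (+ k)     = natR k
  intR -[1+ k ]  = - natR (suc k)

  IsIntegralDomain : Set (Level._⊔_ c ℓ)
  IsIntegralDomain = (¬ (1# ≈ 0#)) Data.Product.× (∀ x y → x * y ≈ 0# → x ≈ 0# ⊎ y ≈ 0#)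

  CharZero : Set ℓ
  CharZero = ∀ k → ¬ (natR (suc k) ≈ 0#)

  IsPrimitiveRoot : ℕ → Carrier → Set ℓ
  IsPrimitiveRoot n ζ = (pow ζ n ≈ 1#) Data.Product.× (∀ d → 0 Data.Nat.< d → d Data.Nat.< n → ¬ (pow ζ d ≈ 1#))

  sumFin : (n : ℕ) → (Fin n → Carrier) → Carrier
  sumFin zero    f = 0#
  sumFin (suc n) f = f Fin.zero + sumFin n (λ i → f (Fin.suc i))
    where import Data.Fin as Fin

  sumOver : {n : ℕ} → Subset n → (Fin n → Carrier) → Carrier
  sumOver {n} T f = sumFin n (λ i → if lookup T i then f i else 0#)

  module Character (n : ℕ) (ζ : Carrier) where
    -- ζ^(-1) = ζ^(n-1)
    -- χ_h(a^k) = 2cos(2khπ/n) = ζ^(hk) + ζ^(-hk)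
    χ : ℕ → Fin n → Carrier
    χ h k = pow ζ (h *ℕ toℕ k) + pow (pow ζ (n ∸ 1)) (h *ℕ toℕ k)

    χT : ℕ → Subset n → Carrier
    χT h T = sumOver T (χ h)

    -- χ_h(T²) = Σ_{x,y∈T} χ_h(xy),  with a^k a^l = a^(k+l)
    χT² : ℕ → Subset n → Carrier
    χT² h T = sumOver T (λ k → sumOver T (λ l →
               pow ζ (h *ℕ (toℕ k +ℕ toℕ l)) + pow (pow ζ (n ∸ 1)) (h *ℕ (toℕ k +ℕ toℕ l))))

-- The indicator of any T ∈ B(⟨a⟩) is an integer combination Σ cᵢ 1_Hᵢ of indicators of
-- subgroups: the span of these is closed under 1 − f and under products, because an
-- intersection of subgroups is a subgroup, and unions reduce to these by De Morgan.
-- On ⟨a⟩ we have χ_h = ψ + ψ⁻¹ with ψ(a^k) = ζ^(hk). A character sums to |H| over a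
-- subgroup H on which it is trivial and to 0 otherwise (translating by g ∈ H with
-- ψ(g) ≠ 1 multiplies the sum by ψ(g), and R has no zero divisors). For ψ and ψ⁻¹ alike,
-- triviality on H means n ∣ hk for all a^k ∈ H, so Σ_T ψ = Σ_T ψ⁻¹ = a for one integer a.
-- Hence χ_h(T) = 2a, χ_h(T²) = (Σ_T ψ)² + (Σ_T ψ⁻¹)² = 2a², and 2χ_h(T²) = (2a)².

module Submission where

open import Defs
open import Algebra.Bundles using (CommutativeRing)
open import Data.Nat.Base as ℕ using (ℕ; zero; suc; NonZero; _%_; _/_; _∸_)
import Data.Nat.Properties as ℕ
open import Data.Nat.DivMod
  using (m≡m%n+[m/n]*n; m%n<n; %-distribˡ-+; %-distribˡ-*; m%n%n≡m%n; m<n⇒m%n≡m; n%n≡0)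
open import Data.Nat.Divisibility using (_∣_; _∣?_; divides; m%n≡0⇒n∣m)
open import Data.Integer.Base as ℤ using (ℤ; 0ℤ; 1ℤ; -[1+_]; _⊖_)
import Data.Integer.Properties as ℤ
open import Data.Integer.Tactic.RingSolver using (solve-∀)
open import Data.Sign.Base as Sign using (Sign)
open import Data.Fin.Base using (Fin; toℕ)
open import Data.Fin.Properties using (toℕ-fromℕ<; toℕ-injective; toℕ<n; any?)
open import Data.Fin.Subset using (Subset; _∈_; _∪_; _∩_; ∁; ⊤; ∣_∣)
open import Data.Fin.Subset.Properties using (∈⊤; x∈p∩q⁺; x∈p∩q⁻; _∈?_; ∪-∩-booleanAlgebra)
open import Data.Fin.Permutation using (Permutation; permutation; _⟨$⟩ʳ_)
import Algebra.Lattice.Properties.BooleanAlgebra as BooleanAlgebra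
open import Data.Vec.Base as Vec using (lookup)
open import Data.Vec.Properties using (lookup-map; lookup-zipWith; lookup-replicate; []=⇒lookup; lookup⇒[]=)
open import Data.Bool.Base using (true; false; if_then_else_; not; _∧_)
open import Data.Bool.Properties using (⇔→≡)
open import Data.List.Base using (List; []; _∷_; _++_; map)
open import Data.List.Relation.Unary.All using (All; []; _∷_)
import Data.List.Relation.Unary.All as All
open import Data.List.Relation.Unary.All.Properties using (map⁺; ++⁺)
open import Data.Product.Base as Product using (_,_; proj₁; proj₂)
open import Data.Sum.Base using ([_,_]′)
open import Data.Empty using (⊥-elim)
open import Function.Base using (_∘_; id)
open import Function.Bundles using (_⇔_; mk⇔; Equivalence)
open import Relation.Nullary using (¬_; yes; no; ¬?; _×-dec_)
open import Relation.Nullary.Decidable using (decidable-stable)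
open import Relation.Unary using (Pred; Decidable)
open import Relation.Binary.PropositionalEquality as ≡ using (_≡_)

module IntegerEmbedding {c ℓ} (R : CommutativeRing c ℓ) where
  open CommutativeRing R
  open import Algebra.Properties.Ring ring using (-‿+-comm; -0#≈0#; -1*x≈-x; -‿involutive; -‿distribʳ-*)
  open import Algebra.Properties.CommutativeSemigroup +-commutativeSemigroup using (interchange)
  import Algebra.Properties.CommutativeSemigroup *-commutativeSemigroup as *-CS
  open import Algebra.Properties.Semiring.Mult semiring using (_×_; ×-homo-+; ×1-homo-*)
  open import Relation.Binary.Reasoning.Setoid setoid

  natR≡×1# : ∀ k → natR R k ≡ k × 1#
  natR≡×1# zero    = ≡.refl
  natR≡×1# (suc k) = ≡.cong (1# +_) (natR≡×1# k)

  natR-+ : ∀ a b → natR R (a ℕ.+ b) ≈ natR R a + natR R b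
  natR-+ a b rewrite natR≡×1# (a ℕ.+ b) | natR≡×1# a | natR≡×1# b = ×-homo-+ 1# a b

  natR-* : ∀ a b → natR R (a ℕ.* b) ≈ natR R a * natR R b
  natR-* a b rewrite natR≡×1# (a ℕ.* b) | natR≡×1# a | natR≡×1# b = ×1-homo-* a b

  intR-⊖ : ∀ a b → intR R (a ⊖ b) ≈ natR R a - natR R b
  intR-⊖ a       zero    = sym (trans (+-congˡ -0#≈0#) (+-identityʳ _))
  intR-⊖ zero    (suc b) = sym (+-identityˡ _)
  intR-⊖ (suc a) (suc b) = begin
    intR R (suc a ⊖ suc b)              ≡⟨ ≡.cong (intR R) (ℤ.[1+m]⊖[1+n]≡m⊖n a b) ⟩
    intR R (a ⊖ b)                      ≈⟨ intR-⊖ a b ⟩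
    natR R a - natR R b                 ≈⟨ +-identityˡ _ ⟨
    0# + (natR R a - natR R b)          ≈⟨ +-congʳ (-‿inverseʳ 1#) ⟨
    (1# - 1#) + (natR R a - natR R b)   ≈⟨ interchange _ _ _ _ ⟩
    natR R (suc a) + (- 1# - natR R b)  ≈⟨ +-congˡ (-‿+-comm _ _) ⟩
    natR R (suc a) - natR R (suc b)     ∎

  intR-+ : ∀ x y → intR R (x ℤ.+ y) ≈ intR R x + intR R y
  intR-+ (ℤ.+ a)  (ℤ.+ b)  = natR-+ a b
  intR-+ (ℤ.+ a)  -[1+ b ] = intR-⊖ a (suc b)
  intR-+ -[1+ a ] (ℤ.+ b)  = trans (intR-⊖ b (suc a)) (+-comm _ _)
  intR-+ -[1+ a ] -[1+ b ] = begin
    - natR R (suc (suc (a ℕ.+ b)))      ≡⟨ ≡.cong (λ k → - natR R k) (ℕ.+-suc (suc a) b) ⟨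
    - natR R (suc a ℕ.+ suc b)          ≈⟨ -‿cong (natR-+ (suc a) (suc b)) ⟩
    - (natR R (suc a) + natR R (suc b)) ≈⟨ -‿+-comm _ _ ⟨
    - natR R (suc a) - natR R (suc b)   ∎

  signR : Sign → Carrier
  signR Sign.+ = 1#
  signR Sign.- = - 1#

  signR-* : ∀ s t → signR (s Sign.* t) ≈ signR s * signR t
  signR-* Sign.+ t      = sym (*-identityˡ _)
  signR-* Sign.- Sign.+ = sym (*-identityʳ _)
  signR-* Sign.- Sign.- = begin
    1#              ≈⟨ -‿involutive 1# ⟨
    - - 1#          ≈⟨ -‿cong (-1*x≈-x 1#) ⟨
    - (- 1# * 1#)   ≈⟨ -‿distribʳ-* _ _ ⟩
    - 1# * - 1#     ∎

  intR-◃ : ∀ s k → intR R (s ℤ.◃ k) ≈ signR s * natR R k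
  intR-◃ s      zero    = sym (zeroʳ _)
  intR-◃ Sign.+ (suc k) = sym (*-identityˡ _)
  intR-◃ Sign.- (suc k) = sym (-1*x≈-x _)

  intR≈sign*abs : ∀ x → intR R x ≈ signR (ℤ.sign x) * natR R ℤ.∣ x ∣
  intR≈sign*abs x = trans (reflexive (≡.cong (intR R) (≡.sym (ℤ.◃-inverse x)))) (intR-◃ (ℤ.sign x) ℤ.∣ x ∣)

  intR-* : ∀ x y → intR R (x ℤ.* y) ≈ intR R x * intR R y
  intR-* x y = begin
    intR R (x ℤ.* y)
      ≈⟨ intR-◃ (sx Sign.* sy) (∣x∣ ℕ.* ∣y∣) ⟩
    signR (sx Sign.* sy) * natR R (∣x∣ ℕ.* ∣y∣)
      ≈⟨ *-cong (signR-* sx sy) (natR-* ∣x∣ ∣y∣) ⟩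
    (signR sx * signR sy) * (natR R ∣x∣ * natR R ∣y∣)
      ≈⟨ *-CS.interchange _ _ _ _ ⟩
    (signR sx * natR R ∣x∣) * (signR sy * natR R ∣y∣)
      ≈⟨ *-cong (intR≈sign*abs x) (intR≈sign*abs y) ⟨
    intR R x * intR R y ∎
    where
    sx = ℤ.sign x; sy = ℤ.sign y; ∣x∣ = ℤ.∣ x ∣; ∣y∣ = ℤ.∣ y ∣

module Powers {c ℓ} (R : CommutativeRing c ℓ) where
  open CommutativeRing R
  open import Algebra.Properties.CommutativeSemiring.Exp commutativeSemiring
    using (_^_; ^-homo-*; ^-assocʳ; ^-congˡ; ^-distrib-*)
  open import Relation.Binary.Reasoning.Setoid setoid

  pow≡^ : ∀ x k → pow R x k ≡ x ^ k
  pow≡^ x zero    = ≡.refl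
  pow≡^ x (suc k) = ≡.cong (x *_) (pow≡^ x k)

  pow-+ : ∀ x a b → pow R x (a ℕ.+ b) ≈ pow R x a * pow R x b
  pow-+ x a b rewrite pow≡^ x (a ℕ.+ b) | pow≡^ x a | pow≡^ x b = ^-homo-* x a b

  pow-* : ∀ x a b → pow R (pow R x a) b ≈ pow R x (a ℕ.* b)
  pow-* x a b rewrite pow≡^ (pow R x a) b | pow≡^ x a | pow≡^ x (a ℕ.* b) = ^-assocʳ x a b

  pow-congˡ : ∀ k {x y} → x ≈ y → pow R x k ≈ pow R y k
  pow-congˡ k {x} {y} x≈y rewrite pow≡^ x k | pow≡^ y k = ^-congˡ k x≈y

  pow-distrib-* : ∀ x y k → pow R (x * y) k ≈ pow R x k * pow R y k
  pow-distrib-* x y k rewrite pow≡^ (x * y) k | pow≡^ x k | pow≡^ y k = ^-distrib-* x y k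

  pow-1# : ∀ k → pow R 1# k ≈ 1#
  pow-1# zero    = refl
  pow-1# (suc k) = trans (*-identityˡ _) (pow-1# k)

  module _ {n : ℕ} .{{_ : NonZero n}} {z : Carrier} (zⁿ≈1 : pow R z n ≈ 1#) where

    pow-multiple : ∀ q → pow R z (q ℕ.* n) ≈ 1#
    pow-multiple q = begin
      pow R z (q ℕ.* n)     ≡⟨ ≡.cong (pow R z) (ℕ.*-comm q n) ⟩
      pow R z (n ℕ.* q)     ≈⟨ pow-* z n q ⟨
      pow R (pow R z n) q   ≈⟨ pow-congˡ q zⁿ≈1 ⟩
      pow R 1# q            ≈⟨ pow-1# q ⟩
      1#                    ∎

    pow-mod : ∀ j → pow R z j ≈ pow R z (j % n)
    pow-mod j = begin
      pow R z j                                   ≡⟨ ≡.cong (pow R z) (m≡m%n+[m/n]*n j n) ⟩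
      pow R z (j % n ℕ.+ (j / n) ℕ.* n)           ≈⟨ pow-+ z (j % n) _ ⟩
      pow R z (j % n) * pow R z ((j / n) ℕ.* n)   ≈⟨ *-congˡ (pow-multiple (j / n)) ⟩
      pow R z (j % n) * 1#                        ≈⟨ *-identityʳ _ ⟩
      pow R z (j % n)                             ∎

    pow-cong-mod : ∀ {i j} → i % n ≡ j % n → pow R z i ≈ pow R z j
    pow-cong-mod {i} {j} i≡j = trans (pow-mod i) (trans (reflexive (≡.cong (pow R z) i≡j)) (sym (pow-mod j)))

  pow-pred-inverse : ∀ {n z} .{{_ : NonZero n}} → pow R z n ≈ 1# → z * pow R z (n ∸ 1) ≈ 1#
  pow-pred-inverse {n} {z} zⁿ≈1 = trans (reflexive (≡.cong (pow R z) (ℕ.suc-pred n))) zⁿ≈1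

  HasOrder : ℕ → Carrier → Set ℓ
  HasOrder n z = ∀ j → pow R z j ≈ 1# ⇔ n ∣ j

  hasOrder⇒powⁿ≈1 : ∀ {n z} → HasOrder n z → pow R z n ≈ 1#
  hasOrder⇒powⁿ≈1 {n} order = Equivalence.from (order n) (divides 1 (≡.sym (ℕ.*-identityˡ n)))

  primitive⇒hasOrder : ∀ {n ζ} .{{_ : NonZero n}} → IsPrimitiveRoot R n ζ → HasOrder n ζ
  primitive⇒hasOrder {n} {ζ} (ζⁿ≈1 , minimal) j = mk⇔ to from
    where
    to : pow R ζ j ≈ 1# → n ∣ j
    to ζʲ≈1 with j % n in j%n≡r
    ... | zero  = m%n≡0⇒n∣m j n j%n≡r
    ... | suc r = ⊥-elim (minimal (suc r) (ℕ.s≤s ℕ.z≤n) (≡.subst (ℕ._< n) j%n≡r (m%n<n j n))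
                    (trans (sym (trans (pow-mod ζⁿ≈1 j) (reflexive (≡.cong (pow R ζ) j%n≡r)))) ζʲ≈1))
    from : n ∣ j → pow R ζ j ≈ 1#
    from (divides q ≡.refl) = pow-multiple ζⁿ≈1 q

  xy≈1∧x≈1⇒y≈1 : ∀ {x y} → x * y ≈ 1# → x ≈ 1# → y ≈ 1#
  xy≈1∧x≈1⇒y≈1 {x} {y} xy≈1 x≈1 = begin
    y       ≈⟨ *-identityˡ y ⟨
    1# * y  ≈⟨ *-congʳ x≈1 ⟨
    x * y   ≈⟨ xy≈1 ⟩
    1#      ∎

  inverse-hasOrder : ∀ {n x y} → x * y ≈ 1# → HasOrder n x → HasOrder n y
  inverse-hasOrder {n} {x} {y} xy≈1 order j = mk⇔
    (λ yʲ≈1 → Equivalence.to (order j) (xy≈1∧x≈1⇒y≈1 (trans (*-comm _ _) xʲyʲ≈1) yʲ≈1))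
    (λ n∣j → xy≈1∧x≈1⇒y≈1 xʲyʲ≈1 (Equivalence.from (order j) n∣j))
    where
    xʲyʲ≈1 : pow R x j * pow R y j ≈ 1#
    xʲyʲ≈1 = trans (sym (pow-distrib-* x y j)) (trans (pow-congˡ j xy≈1) (pow-1# j))

[m+n%d]%d≡[m+n]%d : ∀ m n d .{{_ : NonZero d}} → (m ℕ.+ n % d) % d ≡ (m ℕ.+ n) % d
[m+n%d]%d≡[m+n]%d m n d = begin
  (m ℕ.+ n % d) % d           ≡⟨ %-distribˡ-+ m (n % d) d ⟩
  (m % d ℕ.+ n % d % d) % d   ≡⟨ ≡.cong (λ r → (m % d ℕ.+ r) % d) (m%n%n≡m%n n d) ⟩
  (m % d ℕ.+ n % d) % d       ≡⟨ %-distribˡ-+ m n d ⟨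
  (m ℕ.+ n) % d               ∎
  where open ≡.≡-Reasoning

[m*[n%d]]%d≡[m*n]%d : ∀ m n d .{{_ : NonZero d}} → (m ℕ.* (n % d)) % d ≡ (m ℕ.* n) % d
[m*[n%d]]%d≡[m*n]%d m n d = begin
  (m ℕ.* (n % d)) % d         ≡⟨ %-distribˡ-* m (n % d) d ⟩
  (m % d ℕ.* (n % d % d)) % d ≡⟨ ≡.cong (λ r → (m % d ℕ.* r) % d) (m%n%n≡m%n n d) ⟩
  (m % d ℕ.* (n % d)) % d     ≡⟨ %-distribˡ-* m n d ⟨
  (m ℕ.* n) % d               ∎
  where open ≡.≡-Reasoning

module CyclicGroup (n : ℕ) .{{_ : NonZero n}} where
  open ≡.≡-Reasoning

  toℕ-mulA : ∀ i j → toℕ (mulA n i j) ≡ (toℕ i ℕ.+ toℕ j) % n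
  toℕ-mulA i j = toℕ-fromℕ< (m%n<n (toℕ i ℕ.+ toℕ j) n)

  mulA-cancel : ∀ g g′ k → (toℕ g ℕ.+ toℕ g′) % n ≡ 0 → mulA n g (mulA n g′ k) ≡ k
  mulA-cancel g g′ k gg′≡0 = toℕ-injective (begin
    toℕ (mulA n g (mulA n g′ k))              ≡⟨ toℕ-mulA g _ ⟩
    (toℕ g ℕ.+ toℕ (mulA n g′ k)) % n         ≡⟨ ≡.cong (λ r → (toℕ g ℕ.+ r) % n) (toℕ-mulA g′ k) ⟩
    (toℕ g ℕ.+ (toℕ g′ ℕ.+ toℕ k) % n) % n    ≡⟨ [m+n%d]%d≡[m+n]%d (toℕ g) _ n ⟩
    (toℕ g ℕ.+ (toℕ g′ ℕ.+ toℕ k)) % n        ≡⟨ ≡.cong (_% n) (ℕ.+-assoc (toℕ g) _ _) ⟨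
    (toℕ g ℕ.+ toℕ g′ ℕ.+ toℕ k) % n          ≡⟨ %-distribˡ-+ (toℕ g ℕ.+ toℕ g′) (toℕ k) n ⟩
    ((toℕ g ℕ.+ toℕ g′) % n ℕ.+ toℕ k % n) % n ≡⟨ ≡.cong (λ r → (r ℕ.+ toℕ k % n) % n) gg′≡0 ⟩
    toℕ k % n % n                             ≡⟨ m%n%n≡m%n (toℕ k) n ⟩
    toℕ k % n                                 ≡⟨ m<n⇒m%n≡m (toℕ<n k) ⟩
    toℕ k                                     ∎)

  invA-inverseˡ : ∀ g → (toℕ (invA n g) ℕ.+ toℕ g) % n ≡ 0
  invA-inverseˡ g = begin
    (toℕ (invA n g) ℕ.+ toℕ g) % n      ≡⟨ ≡.cong (λ r → (r ℕ.+ toℕ g) % n) (toℕ-fromℕ< (m%n<n (n ∸ toℕ g) n)) ⟩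
    ((n ∸ toℕ g) % n ℕ.+ toℕ g) % n     ≡⟨ ≡.cong (_% n) (ℕ.+-comm ((n ∸ toℕ g) % n) (toℕ g)) ⟩
    (toℕ g ℕ.+ (n ∸ toℕ g) % n) % n     ≡⟨ [m+n%d]%d≡[m+n]%d (toℕ g) (n ∸ toℕ g) n ⟩
    (toℕ g ℕ.+ (n ∸ toℕ g)) % n         ≡⟨ ≡.cong (_% n) (ℕ.m+[n∸m]≡n (ℕ.<⇒≤ (toℕ<n g))) ⟩
    n % n                               ≡⟨ n%n≡0 n ⟩
    0                                   ∎

  invA-inverseʳ : ∀ g → (toℕ g ℕ.+ toℕ (invA n g)) % n ≡ 0
  invA-inverseʳ g = ≡.trans (≡.cong (_% n) (ℕ.+-comm (toℕ g) _)) (invA-inverseˡ g)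

  translation : Fin n → Permutation n n
  translation g = permutation (mulA n g) (mulA n (invA n g))
    (λ k → mulA-cancel g (invA n g) k (invA-inverseʳ g))
    (λ k → mulA-cancel (invA n g) g k (invA-inverseˡ g))

  ⊤-isSubgroup : IsSubgroup n ⊤
  ⊤-isSubgroup = record { one∈ = ∈⊤ ; mul∈ = λ _ _ → ∈⊤ ; inv∈ = λ _ → ∈⊤ }

  ∩-isSubgroup : ∀ {H K} → IsSubgroup n H → IsSubgroup n K → IsSubgroup n (H ∩ K)
  ∩-isSubgroup {H} {K} H≤ K≤ = record
    { one∈ = x∈p∩q⁺ (IsSubgroup.one∈ H≤ , IsSubgroup.one∈ K≤)
    ; mul∈ = λ i∈ j∈ → let (i∈H , i∈K) = x∈p∩q⁻ H K i∈ ; (j∈H , j∈K) = x∈p∩q⁻ H K j∈ in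
             x∈p∩q⁺ (IsSubgroup.mul∈ H≤ i∈H j∈H , IsSubgroup.mul∈ K≤ i∈K j∈K)
    ; inv∈ = λ i∈ → let (i∈H , i∈K) = x∈p∩q⁻ H K i∈ in
             x∈p∩q⁺ (IsSubgroup.inv∈ H≤ i∈H , IsSubgroup.inv∈ K≤ i∈K)
    }

  lookup-mulA : ∀ {H g} → IsSubgroup n H → g ∈ H → ∀ k → lookup H (mulA n g k) ≡ lookup H k
  lookup-mulA {H} {g} H≤ g∈H k = ⇔→≡ (mk⇔
    (λ gk∈H → []=⇒lookup (≡.subst (_∈ H) (mulA-cancel (invA n g) g k (invA-inverseˡ g))
                (mul∈ (inv∈ g∈H) (lookup⇒[]= _ H gk∈H))))
    (λ k∈H → []=⇒lookup (mul∈ g∈H (lookup⇒[]= k H k∈H))))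
    where open IsSubgroup H≤

∪≡∁[∁∩∁] : ∀ {n} (S U : Subset n) → S ∪ U ≡ ∁ (∁ S ∩ ∁ U)
∪≡∁[∁∩∁] {n} S U = ≡.sym (≡.trans (deMorgan₁ (∁ S) (∁ U)) (≡.cong₂ _∪_ (¬-involutive S) (¬-involutive U)))
  where open BooleanAlgebra (∪-∩-booleanAlgebra n)

module SubgroupSpan (n : ℕ) .{{_ : NonZero n}} where
  open CyclicGroup n
  open import Data.Integer.Base using (_+_; _*_; -_; _-_)
  open import Data.Integer.Properties
    using (+-identityˡ; +-identityʳ; *-identityˡ; *-zeroʳ; +-assoc; *-distribʳ-+; neg-distrib-+; neg-distribˡ-*)
  open ≡.≡-Reasoning

  indicator : Subset n → Fin n → ℤ
  indicator T i = if lookup T i then 1ℤ else 0ℤ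

  indicator-∩ : ∀ S U i → indicator (S ∩ U) i ≡ indicator S i * indicator U i
  indicator-∩ S U i rewrite lookup-zipWith _∧_ i S U with lookup S i | lookup U i
  ... | true  | true  = ≡.refl
  ... | true  | false = ≡.refl
  ... | false | _     = ≡.refl

  indicator-∁ : ∀ S i → indicator (∁ S) i ≡ 1ℤ - indicator S i
  indicator-∁ S i rewrite lookup-map i not S with lookup S i
  ... | true  = ≡.refl
  ... | false = ≡.refl

  indicator-⊤ : ∀ i → indicator ⊤ i ≡ 1ℤ
  indicator-⊤ i = ≡.cong (λ b → if b then 1ℤ else 0ℤ) (lookup-replicate i true)

  Combination : Set
  Combination = List (ℤ Product.× Subset n)

  ⟦_⟧ : Combination → Fin n → ℤ
  ⟦ [] ⟧          i = 0ℤ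
  ⟦ (c , H) ∷ L ⟧ i = c * indicator H i + ⟦ L ⟧ i

  ⟦⟧-++ : ∀ L M i → ⟦ L ++ M ⟧ i ≡ ⟦ L ⟧ i + ⟦ M ⟧ i
  ⟦⟧-++ []            M i = ≡.sym (+-identityˡ (⟦ M ⟧ i))
  ⟦⟧-++ ((c , H) ∷ L) M i = begin
    c * indicator H i + ⟦ L ++ M ⟧ i         ≡⟨ ≡.cong ((c * indicator H i) +_) (⟦⟧-++ L M i) ⟩
    c * indicator H i + (⟦ L ⟧ i + ⟦ M ⟧ i)  ≡⟨ +-assoc (c * indicator H i) (⟦ L ⟧ i) (⟦ M ⟧ i) ⟨
    c * indicator H i + ⟦ L ⟧ i + ⟦ M ⟧ i    ∎

  negate : Combination → Combination
  negate = map (Product.map₁ (-_))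

  ⟦⟧-negate : ∀ L i → ⟦ negate L ⟧ i ≡ - ⟦ L ⟧ i
  ⟦⟧-negate []            i = ≡.refl
  ⟦⟧-negate ((c , H) ∷ L) i rewrite ⟦⟧-negate L i =
    ≡.sym (≡.trans (neg-distrib-+ (c * indicator H i) (⟦ L ⟧ i))
                   (≡.cong (_+ - ⟦ L ⟧ i) (neg-distribˡ-* c (indicator H i))))

  scale : ℤ → Subset n → Combination → Combination
  scale c H = map (Product.map (c *_) (H ∩_))

  ⟦⟧-scale : ∀ c H M i → ⟦ scale c H M ⟧ i ≡ c * indicator H i * ⟦ M ⟧ i
  ⟦⟧-scale c H []            i = ≡.sym (*-zeroʳ (c * indicator H i))
  ⟦⟧-scale c H ((d , K) ∷ M) i rewrite ⟦⟧-scale c H M i | indicator-∩ H K i =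
    rearrange c d (indicator H i) (indicator K i) (⟦ M ⟧ i)
    where
    rearrange : ∀ c d x y m → c * d * (x * y) + c * x * m ≡ c * x * (d * y + m)
    rearrange = solve-∀

  _⊗_ : Combination → Combination → Combination
  []            ⊗ M = []
  ((c , H) ∷ L) ⊗ M = scale c H M ++ (L ⊗ M)

  ⟦⟧-⊗ : ∀ L M i → ⟦ L ⊗ M ⟧ i ≡ ⟦ L ⟧ i * ⟦ M ⟧ i
  ⟦⟧-⊗ []            M i = ≡.refl
  ⟦⟧-⊗ ((c , H) ∷ L) M i rewrite ⟦⟧-++ (scale c H M) (L ⊗ M) i | ⟦⟧-scale c H M i | ⟦⟧-⊗ L M i =
    ≡.sym (*-distribʳ-+ (⟦ M ⟧ i) (c * indicator H i) (⟦ L ⟧ i))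

  AllSubgroups : Combination → Set
  AllSubgroups = All (IsSubgroup n ∘ proj₂)

  ⊗-allSubgroups : ∀ {L M} → AllSubgroups L → AllSubgroups M → AllSubgroups (L ⊗ M)
  ⊗-allSubgroups []        M≤ = []
  ⊗-allSubgroups (H≤ ∷ L≤) M≤ = ++⁺ (map⁺ (All.map (∩-isSubgroup H≤) M≤)) (⊗-allSubgroups L≤ M≤)

  record InSpan (T : Subset n) : Set where
    field
      combination : Combination
      subgroups   : AllSubgroups combination
      indicator≡  : ∀ i → indicator T i ≡ ⟦ combination ⟧ i

  subgroup∈span : ∀ {H} → IsSubgroup n H → InSpan H
  subgroup∈span {H} H≤ = record
    { combination = (1ℤ , H) ∷ []
    ; subgroups   = H≤ ∷ []
    ; indicator≡  = λ i → ≡.sym (≡.trans (+-identityʳ _) (*-identityˡ _))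
    }

  ∩∈span : ∀ {S U} → InSpan S → InSpan U → InSpan (S ∩ U)
  ∩∈span {S} {U} s u = record
    { combination = L ⊗ M
    ; subgroups   = ⊗-allSubgroups (InSpan.subgroups s) (InSpan.subgroups u)
    ; indicator≡  = λ i → ≡.trans (indicator-∩ S U i)
        (≡.trans (≡.cong₂ _*_ (InSpan.indicator≡ s i) (InSpan.indicator≡ u i)) (≡.sym (⟦⟧-⊗ L M i)))
    }
    where L = InSpan.combination s; M = InSpan.combination u

  ∁∈span : ∀ {S} → InSpan S → InSpan (∁ S)
  ∁∈span {S} s = record
    { combination = (1ℤ , ⊤) ∷ negate L
    ; subgroups   = ⊤-isSubgroup ∷ map⁺ (InSpan.subgroups s)
    ; indicator≡  = λ i → begin
        indicator (∁ S) i              ≡⟨ indicator-∁ S i ⟩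
        1ℤ - indicator S i             ≡⟨ ≡.cong (λ x → 1ℤ - x) (InSpan.indicator≡ s i) ⟩
        1ℤ - ⟦ L ⟧ i                   ≡⟨ ≡.cong (λ x → 1ℤ * x - ⟦ L ⟧ i) (indicator-⊤ i) ⟨
        1ℤ * indicator ⊤ i - ⟦ L ⟧ i   ≡⟨ ≡.cong ((1ℤ * indicator ⊤ i) +_) (⟦⟧-negate L i) ⟨
        ⟦ (1ℤ , ⊤) ∷ negate L ⟧ i      ∎
    }
    where L = InSpan.combination s

  inB⇒inSpan : ∀ {T} → InB n T → InSpan T
  inB⇒inSpan (sub H≤)                = subgroup∈span H≤
  inB⇒inSpan (inter S∈B U∈B)         = ∩∈span (inB⇒inSpan S∈B) (inB⇒inSpan U∈B)
  inB⇒inSpan (compl S∈B)             = ∁∈span (inB⇒inSpan S∈B)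
  inB⇒inSpan (union {S} {U} S∈B U∈B) = ≡.subst InSpan (≡.sym (∪≡∁[∁∩∁] S U))
    (∁∈span (∩∈span (∁∈span (inB⇒inSpan S∈B)) (∁∈span (inB⇒inSpan U∈B))))

module SubsetSums {c ℓ} (R : CommutativeRing c ℓ) where
  open CommutativeRing R
  open import Algebra.Properties.Semiring.Sum semiring
    using (sum; sum-cong-≋; ∑-distrib-+; *-distribˡ-sum; sum-permute)
  open import Relation.Binary.Reasoning.Setoid setoid

  sumFin≡sum : ∀ n f → sumFin R n f ≡ sum f
  sumFin≡sum zero    f = ≡.refl
  sumFin≡sum (suc n) f = ≡.cong (f Fin.zero +_) (sumFin≡sum n (f ∘ Fin.suc))
    where import Data.Fin.Base as Fin

  module _ {n : ℕ} where

    sumFin-cong : ∀ {f g} → (∀ i → f i ≈ g i) → sumFin R n f ≈ sumFin R n g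
    sumFin-cong {f} {g} f≈g rewrite sumFin≡sum n f | sumFin≡sum n g = sum-cong-≋ f≈g

    sumFin-+ : ∀ f g → sumFin R n (λ i → f i + g i) ≈ sumFin R n f + sumFin R n g
    sumFin-+ f g rewrite sumFin≡sum n (λ i → f i + g i) | sumFin≡sum n f | sumFin≡sum n g = ∑-distrib-+ f g

    sumFin-*ˡ : ∀ x f → sumFin R n (λ i → x * f i) ≈ x * sumFin R n f
    sumFin-*ˡ x f rewrite sumFin≡sum n (λ i → x * f i) | sumFin≡sum n f = sym (*-distribˡ-sum x f)

    sumFin-permute : ∀ f (π : Permutation n n) → sumFin R n f ≈ sumFin R n (f ∘ (π ⟨$⟩ʳ_))
    sumFin-permute f π rewrite sumFin≡sum n f | sumFin≡sum n (f ∘ (π ⟨$⟩ʳ_)) = sum-permute f π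

    sumOver-cong : ∀ (T : Subset n) {f g} → (∀ i → i ∈ T → f i ≈ g i) → sumOver R T f ≈ sumOver R T g
    sumOver-cong T {f} {g} f≈g = sumFin-cong pointwise
      where
      pointwise : ∀ i → (if lookup T i then f i else 0#) ≈ (if lookup T i then g i else 0#)
      pointwise i with lookup T i in i∈T
      ... | true  = f≈g i (lookup⇒[]= i T i∈T)
      ... | false = refl

    sumOver-+ : ∀ (T : Subset n) f g → sumOver R T (λ i → f i + g i) ≈ sumOver R T f + sumOver R T g
    sumOver-+ T f g = trans (sumFin-cong pointwise) (sumFin-+ _ _)
      where
      pointwise : ∀ i → (if lookup T i then f i + g i else 0#)
                        ≈ (if lookup T i then f i else 0#) + (if lookup T i then g i else 0#)
      pointwise i with lookup T i
      ... | true  = refl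
      ... | false = sym (+-identityˡ 0#)

    sumOver-*ˡ : ∀ (T : Subset n) x f → sumOver R T (λ i → x * f i) ≈ x * sumOver R T f
    sumOver-*ˡ T x f = trans (sumFin-cong pointwise) (sumFin-*ˡ x _)
      where
      pointwise : ∀ i → (if lookup T i then x * f i else 0#) ≈ x * (if lookup T i then f i else 0#)
      pointwise i with lookup T i
      ... | true  = refl
      ... | false = sym (zeroʳ x)

    sumOver-square : ∀ (T : Subset n) f →
      sumOver R T (λ k → sumOver R T (λ l → f k * f l)) ≈ sumOver R T f * sumOver R T f
    sumOver-square T f = begin
      sumOver R T (λ k → sumOver R T (λ l → f k * f l))  ≈⟨ sumOver-cong T (λ k _ → sumOver-*ˡ T (f k) f) ⟩
      sumOver R T (λ k → f k * sumOver R T f)            ≈⟨ sumOver-cong T (λ k _ → *-comm (f k) _) ⟩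
      sumOver R T (λ k → sumOver R T f * f k)            ≈⟨ sumOver-*ˡ T (sumOver R T f) f ⟩
      sumOver R T f * sumOver R T f                      ∎

  sumOver-ones : ∀ {n} (T : Subset n) → sumOver R T (λ _ → 1#) ≈ natR R ∣ T ∣
  sumOver-ones Vec.[]          = refl
  sumOver-ones (true Vec.∷ T)  = +-congˡ (sumOver-ones T)
  sumOver-ones (false Vec.∷ T) = trans (+-identityˡ _) (sumOver-ones T)

module CharacterSums {c ℓ} (R : CommutativeRing c ℓ) (n : ℕ) .{{_ : NonZero n}} where
  open CommutativeRing R
  open import Algebra.Properties.Ring ring using ([y-z]x≈yx-zx; x∙y⁻¹≈ε⇒x≈y)
  open import Relation.Binary.Reasoning.Setoid setoid
  open IntegerEmbedding R
  open SubsetSums R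
  open CyclicGroup n
  open SubgroupSpan n

  Multiplicative : (Fin n → Carrier) → Set ℓ
  Multiplicative f = ∀ g k → f (mulA n g k) ≈ f g * f k

  sumOver-translate : ∀ {H g} → IsSubgroup n H → g ∈ H → ∀ f → sumOver R H (f ∘ mulA n g) ≈ sumOver R H f
  sumOver-translate {H} {g} H≤ g∈H f = sym (trans (sumFin-permute _ (translation g)) (sumFin-cong pointwise))
    where
    pointwise : ∀ k → (if lookup H (mulA n g k) then f (mulA n g k) else 0#)
                      ≈ (if lookup H k then f (mulA n g k) else 0#)
    pointwise k rewrite lookup-mulA H≤ g∈H k = refl

  sumOver-nontrivial : IsIntegralDomain R → ∀ {H f g} → IsSubgroup n H → Multiplicative f →
                       g ∈ H → ¬ f g ≈ 1# → sumOver R H f ≈ 0#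
  sumOver-nontrivial domain {H} {f} {g} H≤ f-mult g∈H fg≉1 =
    [ (λ fg-1≈0 → ⊥-elim (fg≉1 (x∙y⁻¹≈ε⇒x≈y (f g) 1# fg-1≈0))) , id ]′ (proj₂ domain (f g - 1#) S [fg-1]S≈0)
    where
    S = sumOver R H f
    S≈fg*S : S ≈ f g * S
    S≈fg*S = begin
      S                                    ≈⟨ sumOver-translate H≤ g∈H f ⟨
      sumOver R H (f ∘ mulA n g)           ≈⟨ sumOver-cong H (λ k _ → f-mult g k) ⟩
      sumOver R H (λ k → f g * f k)        ≈⟨ sumOver-*ˡ H (f g) f ⟩
      f g * S                              ∎
    [fg-1]S≈0 : (f g - 1#) * S ≈ 0#
    [fg-1]S≈0 = begin
      (f g - 1#) * S      ≈⟨ [y-z]x≈yx-zx S (f g) 1# ⟩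
      f g * S - 1# * S    ≈⟨ +-cong (sym S≈fg*S) (-‿cong (*-identityˡ S)) ⟩
      S - S               ≈⟨ -‿inverseʳ S ⟩
      0#                  ∎

  sizeIf⊆ : ∀ {p} {P : Pred (Fin n) p} → Decidable P → Subset n → ℕ
  sizeIf⊆ P? H with any? (λ g → (g ∈? H) ×-dec ¬? (P? g))
  ... | yes _ = 0
  ... | no  _ = ∣ H ∣

  combinationValue : ∀ {p} {P : Pred (Fin n) p} → Decidable P → Combination → ℤ
  combinationValue P? []            = 0ℤ
  combinationValue P? ((c , H) ∷ L) = c ℤ.* ℤ.+ sizeIf⊆ P? H ℤ.+ combinationValue P? L

  weightedSum : (Fin n → ℤ) → (Fin n → Carrier) → Carrier
  weightedSum w f = sumFin R n (λ i → intR R (w i) * f i)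

  sumOver≈weightedSum : ∀ T f → sumOver R T f ≈ weightedSum (indicator T) f
  sumOver≈weightedSum T f = sumFin-cong pointwise
    where
    pointwise : ∀ i → (if lookup T i then f i else 0#) ≈ intR R (indicator T i) * f i
    pointwise i with lookup T i
    ... | true  = sym (trans (*-congʳ (+-identityʳ 1#)) (*-identityˡ (f i)))
    ... | false = sym (zeroˡ (f i))

  module _ (domain : IsIntegralDomain R) {f : Fin n → Carrier} (f-mult : Multiplicative f)
           {p} {P : Pred (Fin n) p} (P? : Decidable P) (kernel : ∀ k → f k ≈ 1# ⇔ P k) where

    sumOver-subgroup : ∀ {H} → IsSubgroup n H → sumOver R H f ≈ natR R (sizeIf⊆ P? H)
    sumOver-subgroup {H} H≤ with any? (λ g → (g ∈? H) ×-dec ¬? (P? g))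
    ... | yes (g , g∈H , ¬Pg) = sumOver-nontrivial domain H≤ f-mult g∈H (¬Pg ∘ Equivalence.to (kernel g))
    ... | no  H⊈P             = trans (sumOver-cong H fk≈1) (sumOver-ones H)
      where
      fk≈1 : ∀ k → k ∈ H → f k ≈ 1#
      fk≈1 k k∈H = Equivalence.from (kernel k) (decidable-stable (P? k) (λ ¬Pk → H⊈P (k , k∈H , ¬Pk)))

    weightedSum-combination : ∀ {L} → AllSubgroups L → weightedSum ⟦ L ⟧ f ≈ intR R (combinationValue P? L)
    weightedSum-combination {[]}          []        = trans (sumFin-*ˡ 0# f) (zeroˡ _)
    weightedSum-combination {(c , H) ∷ L} (H≤ ∷ L≤) = begin
      weightedSum ⟦ (c , H) ∷ L ⟧ f
        ≈⟨ sumFin-cong split ⟩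
      sumFin R n (λ i → intR R c * (intR R (indicator H i) * f i) + intR R (⟦ L ⟧ i) * f i)
        ≈⟨ sumFin-+ (λ i → intR R c * (intR R (indicator H i) * f i)) (λ i → intR R (⟦ L ⟧ i) * f i) ⟩
      sumFin R n (λ i → intR R c * (intR R (indicator H i) * f i)) + weightedSum ⟦ L ⟧ f
        ≈⟨ +-cong (sumFin-*ˡ (intR R c) (λ i → intR R (indicator H i) * f i)) (weightedSum-combination L≤) ⟩
      intR R c * weightedSum (indicator H) f + intR R (combinationValue P? L)
        ≈⟨ +-congʳ (*-congˡ (trans (sym (sumOver≈weightedSum H f)) (sumOver-subgroup H≤))) ⟩
      intR R c * natR R (sizeIf⊆ P? H) + intR R (combinationValue P? L)
        ≈⟨ +-congʳ (intR-* c (ℤ.+ sizeIf⊆ P? H)) ⟨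
      intR R (c ℤ.* ℤ.+ sizeIf⊆ P? H) + intR R (combinationValue P? L)
        ≈⟨ intR-+ (c ℤ.* ℤ.+ sizeIf⊆ P? H) (combinationValue P? L) ⟨
      intR R (combinationValue P? ((c , H) ∷ L)) ∎
      where
      split : ∀ i → intR R (c ℤ.* indicator H i ℤ.+ ⟦ L ⟧ i) * f i
                    ≈ intR R c * (intR R (indicator H i) * f i) + intR R (⟦ L ⟧ i) * f i
      split i = begin
        intR R (c ℤ.* indicator H i ℤ.+ ⟦ L ⟧ i) * f i
          ≈⟨ *-congʳ (trans (intR-+ (c ℤ.* indicator H i) (⟦ L ⟧ i)) (+-congʳ (intR-* c (indicator H i)))) ⟩
        (intR R c * intR R (indicator H i) + intR R (⟦ L ⟧ i)) * f i
          ≈⟨ distribʳ _ _ _ ⟩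
        intR R c * intR R (indicator H i) * f i + intR R (⟦ L ⟧ i) * f i
          ≈⟨ +-congʳ (*-assoc _ _ _) ⟩
        intR R c * (intR R (indicator H i) * f i) + intR R (⟦ L ⟧ i) * f i  ∎

    sumOver-span : ∀ {T} (T∈span : InSpan T) →
      sumOver R T f ≈ intR R (combinationValue P? (InSpan.combination T∈span))
    sumOver-span {T} T∈span = begin
      sumOver R T f                             ≈⟨ sumOver≈weightedSum T f ⟩
      weightedSum (indicator T) f
        ≈⟨ sumFin-cong (λ i → reflexive (≡.cong (λ m → intR R m * f i) (indicator≡ i))) ⟩
      weightedSum ⟦ combination ⟧ f             ≈⟨ weightedSum-combination subgroups ⟩
      intR R (combinationValue P? combination)  ∎
      where open InSpan T∈span

module PowerCharacters {c ℓ} (R : CommutativeRing c ℓ) (n : ℕ) .{{_ : NonZero n}} (h : ℕ) where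
  open CommutativeRing R
  open import Relation.Binary.Reasoning.Setoid setoid
  open Powers R
  open CyclicGroup n
  open SubgroupSpan n
  open CharacterSums R n

  powerCharacter : Carrier → Fin n → Carrier
  powerCharacter z k = pow R z (h ℕ.* toℕ k)

  powerCharacter-+ : ∀ z a b → pow R z (h ℕ.* (a ℕ.+ b)) ≈ pow R z (h ℕ.* a) * pow R z (h ℕ.* b)
  powerCharacter-+ z a b =
    trans (reflexive (≡.cong (pow R z) (ℕ.*-distribˡ-+ h a b))) (pow-+ z (h ℕ.* a) (h ℕ.* b))

  powerCharacter-multiplicative : ∀ {z} → pow R z n ≈ 1# → Multiplicative (powerCharacter z)
  powerCharacter-multiplicative {z} zⁿ≈1 g k = begin
    pow R z (h ℕ.* toℕ (mulA n g k))                ≡⟨ ≡.cong (λ r → pow R z (h ℕ.* r)) (toℕ-mulA g k) ⟩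
    pow R z (h ℕ.* ((toℕ g ℕ.+ toℕ k) ℕ.% n))       ≈⟨ pow-cong-mod zⁿ≈1 ([m*[n%d]]%d≡[m*n]%d h _ n) ⟩
    pow R z (h ℕ.* (toℕ g ℕ.+ toℕ k))               ≈⟨ powerCharacter-+ z (toℕ g) (toℕ k) ⟩
    powerCharacter z g * powerCharacter z k         ∎

  annihilates? : Decidable (λ (k : Fin n) → n ∣ h ℕ.* toℕ k)
  annihilates? k = n ∣? h ℕ.* toℕ k

  spanValue : ∀ {T} → InSpan T → ℤ
  spanValue T∈span = combinationValue annihilates? (InSpan.combination T∈span)

  sumOver-powerCharacter : IsIntegralDomain R → ∀ {z T} → HasOrder n z → (T∈span : InSpan T) →
    sumOver R T (powerCharacter z) ≈ intR R (spanValue T∈span)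
  sumOver-powerCharacter domain order =
    sumOver-span domain (powerCharacter-multiplicative (hasOrder⇒powⁿ≈1 order))
                 annihilates? (λ k → order (h ℕ.* toℕ k))

module DihedralCharacter {c ℓ} (R : CommutativeRing c ℓ) (n : ℕ) .{{_ : NonZero n}}
                         (ζ : CommutativeRing.Carrier R) (h : ℕ) where
  open CommutativeRing R
  open import Relation.Binary.Reasoning.Setoid setoid
  open Character R n ζ
  open Powers R
  open SubsetSums R
  open PowerCharacters R n h

  ζ⁻¹ : Carrier
  ζ⁻¹ = pow R ζ (n ∸ 1)

  ζ⁻¹-hasOrder : IsPrimitiveRoot R n ζ → HasOrder n ζ⁻¹
  ζ⁻¹-hasOrder ζ-primitive =
    inverse-hasOrder (pow-pred-inverse (proj₁ ζ-primitive)) (primitive⇒hasOrder ζ-primitive)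

  ψ ψ⁻¹ : Fin n → Carrier
  ψ   = powerCharacter ζ
  ψ⁻¹ = powerCharacter ζ⁻¹

  χT≈ψ+ψ⁻¹ : ∀ T → χT h T ≈ sumOver R T ψ + sumOver R T ψ⁻¹
  χT≈ψ+ψ⁻¹ T = sumOver-+ T ψ ψ⁻¹

  χT²≈ψ²+[ψ⁻¹]² : ∀ T → χT² h T ≈ sumOver R T ψ * sumOver R T ψ + sumOver R T ψ⁻¹ * sumOver R T ψ⁻¹
  χT²≈ψ²+[ψ⁻¹]² T = begin
    χT² h T
      ≈⟨ sumOver-cong T (λ k _ → sumOver-cong T (λ l _ →
           +-cong (powerCharacter-+ ζ (toℕ k) (toℕ l)) (powerCharacter-+ ζ⁻¹ (toℕ k) (toℕ l)))) ⟩
    sumOver R T (λ k → sumOver R T (λ l → ψ k * ψ l + ψ⁻¹ k * ψ⁻¹ l))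
      ≈⟨ sumOver-cong T (λ k _ → sumOver-+ T (λ l → ψ k * ψ l) (λ l → ψ⁻¹ k * ψ⁻¹ l)) ⟩
    sumOver R T (λ k → sumOver R T (λ l → ψ k * ψ l) + sumOver R T (λ l → ψ⁻¹ k * ψ⁻¹ l))
      ≈⟨ sumOver-+ T _ _ ⟩
    sumOver R T (λ k → sumOver R T (λ l → ψ k * ψ l))
      + sumOver R T (λ k → sumOver R T (λ l → ψ⁻¹ k * ψ⁻¹ l))
      ≈⟨ +-cong (sumOver-square T ψ) (sumOver-square T ψ⁻¹) ⟩
    sumOver R T ψ * sumOver R T ψ + sumOver R T ψ⁻¹ * sumOver R T ψ⁻¹ ∎

open import Data.Nat.Base using (_≤_; _<_; _*_)
open import Data.Integer.Base using (+_)
import Data.Integer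
open import Data.Product.Base using (Σ; _×_)

corollary3p1 : ∀ {c ℓ} (R : CommutativeRing c ℓ) → IsIntegralDomain R → CharZero R →
    (n : ℕ) .{{_ : NonZero n}} → (ζ : CommutativeRing.Carrier R) → IsPrimitiveRoot R n ζ →
    (T : Subset n) → InB n T →
    (h : ℕ) → 1 ≤ h → 2 * h < n →
    Σ ℤ (λ m₁ → Σ ℤ (λ m₂ → Σ ℤ (λ w →
      CommutativeRing._≈_ R (Character.χT R n ζ h T) (intR R m₁) ×
      CommutativeRing._≈_ R (Character.χT² R n ζ h T) (intR R m₂) ×
      (+ 2) Data.Integer.* m₂ ≡ w Data.Integer.* w)))
corollary3p1 R domain _ n ζ ζ-primitive T T∈B h _ _ =
  a ℤ.+ a , a ℤ.* a ℤ.+ a ℤ.* a , a ℤ.+ a , χT≈2a , χT²≈2a² , twice-sum-of-squares a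
  where
  open CommutativeRing R using (_≈_; trans; sym; +-cong; *-cong)
  open Character R n ζ using (χT; χT²)
  open IntegerEmbedding R
  open Powers R
  open SubgroupSpan n
  open PowerCharacters R n h
  open DihedralCharacter R n ζ h

  T∈span : InSpan T
  T∈span = inB⇒inSpan T∈B

  a : ℤ
  a = spanValue T∈span

  ∑ψ≈a : sumOver R T ψ ≈ intR R a
  ∑ψ≈a = sumOver-powerCharacter domain (primitive⇒hasOrder ζ-primitive) T∈span

  ∑ψ⁻¹≈a : sumOver R T ψ⁻¹ ≈ intR R a
  ∑ψ⁻¹≈a = sumOver-powerCharacter domain (ζ⁻¹-hasOrder ζ-primitive) T∈span

  χT≈2a : χT h T ≈ intR R (a ℤ.+ a)
  χT≈2a = trans (χT≈ψ+ψ⁻¹ T) (trans (+-cong ∑ψ≈a ∑ψ⁻¹≈a) (sym (intR-+ a a)))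

  χT²≈2a² : χT² h T ≈ intR R (a ℤ.* a ℤ.+ a ℤ.* a)
  χT²≈2a² = trans (χT²≈ψ²+[ψ⁻¹]² T) (trans (+-cong (*-cong ∑ψ≈a ∑ψ≈a) (*-cong ∑ψ⁻¹≈a ∑ψ⁻¹≈a))
              (sym (trans (intR-+ (a ℤ.* a) (a ℤ.* a)) (+-cong (intR-* a a) (intR-* a a)))))

  twice-sum-of-squares : ∀ x → + 2 ℤ.* (x ℤ.* x ℤ.+ x ℤ.* x) ≡ (x ℤ.+ x) ℤ.* (x ℤ.+ x)
  twice-sum-of-squares = solve-∀
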